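{- Let $F_7^{ -4}$ be the rank-$3$ matroid on $\{0,1,2,3,0',1',2'\}$ whose bases are all $3$-element subsets except $\{3,0,0'\},\{3,1,1'\},\{3,2,2'\}$, and let $F_7^{ -5}$ be the rank-$3$ matroid on $\{0,1,2,4,0',1',2'\}$ whose bases are all $3$-element subsets except $\{4,0,0'\},\{4,2,2'\}$. Let $P_1\in\mathbb{R}[x_0,x_1,x_2,x_3]$ and $P_2\in\mathbb{R}[x_0,x_1,x_2,x_4]$ be obtained from the bases generating polynomials $h_{F_7^{ -4}}=\sum_B\prod_{i\in B}x_i$ and $h_{F_7^{ -5}}=\sum_B\prod_{i\in B}x_i$ respectively by substituting $x_{0'}=x_0$, $x_{1'}=x_1$, $x_{2'}=x_2$. Let $J_1=\operatorname{supp}(P_1)\subseteq\mathbb{N}_0^{\{0,1,2,3\}}$, $J_2=\operatorname{supp}(P_2)\subseteq\mathbb{N}_0^{\{0,1,2,4\}}$ and $r_k=r_{J_k}$ for $k=1,2$. Then for every $m\in\mathbb{N}$, the polymatroids $m\cdot r_1$ on $\{0,1,2,3\}$ and $m\cdot r_2$ on $\{0,1,2,4\}$ do not have an amalgam.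
   Context: The support $\operatorname{supp}(P)$ of a polynomial is the set of exponent vectors of its monomials with nonzero coefficient. For $J\subseteq\mathbb{N}_0^E$ finite and nonempty, $r_J\colon 2^E\to\mathbb{N}_0$ is $r_J(S)=\max\{\sum_{i\in S}\alpha_i\mid\alpha\in J\}$. A polymatroid on a finite set $E$ is a function $r\colon2^E\to\mathbb{N}_0$ with $r(\emptyset)=0$, $r(S)\le r(T)$ for $S\subseteq T$, and $r(S\cup T)+r(S\cap T)\le r(S)+r(T)$. $m\cdot r$ denotes the function $S\mapsto m\,r(S)$. For polymatroids $r_1$ on $E_1$ and $r_2$ on $E_2$, an amalgam is a polymatroid $r$ on $E_1\cup E_2$ with $r(S)=r_1(S)$ for all $S\subseteq E_1$ and $r(S)=r_2(S)$ for all $S\subseteq E_2$. -}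

module Defs where

open import Data.Nat using (ℕ; zero; suc; _+_; _*_; _⊔_; _≤_)
open import Data.Bool using (Bool; true; false; if_then_else_; not; _∧_)
open import Data.Fin using (Fin; zero; suc)
open import Data.Fin.Subset using (Subset; _⊆_; _∪_; _∩_; ∣_∣; outside; inside)
open import Data.Vec using (Vec; []; _∷_; tabulate; lookup)
open import Data.List using (List; []; _∷_; map; filter; foldr; _++_)
open import Data.Product using (_×_)
open import Relation.Nullary using (Dec; yes; no; ¬_)
open import Relation.Nullary.Decidable using (⌊_⌋)
open import Relation.Binary.PropositionalEquality using (_≡_)
import Data.Nat as ℕ
import Data.Vec.Properties as VecP
import Data.Bool as B

allSubsets : (n : ℕ) → List (Subset n)
allSubsets zero = [] ∷ []
allSubsets (suc n) = map (false ∷_) (allSubsets n) ++ map (true ∷_) (allSubsets n)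

_≟ˢ_ : {n : ℕ} → (A B : Subset n) → Dec (A ≡ B)
_≟ˢ_ = VecP.≡-dec B._≟_

Σ : (n : ℕ) → (Fin n → ℕ) → ℕ
Σ zero f = 0
Σ (suc n) f = f zero + Σ n (λ i → f (suc i))

sumOver : {n : ℕ} → Subset n → (Fin n → ℕ) → ℕ
sumOver {n} S α = Σ n (λ i → if lookup S i then α i else 0)

maxList : List ℕ → ℕ
maxList = foldr _⊔_ 0

record IsPolymatroid {n : ℕ} (r : Subset n → ℕ) : Set where
  field
    normalized : r (Data.Fin.Subset.⊥) ≡ 0
    monotone   : ∀ S T → S ⊆ T → r S ≤ r T
    submodular : ∀ S T → r (S ∪ T) + r (S ∩ T) ≤ r S + r T

_·ʳ_ : {n : ℕ} → ℕ → (Subset n → ℕ) → (Subset n → ℕ)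
(m ·ʳ r) S = m * r S

-- Matroids: ground set {0,1,2,e,0',1',2'} encoded as Fin 7 in the order
--   0 ↦ 0, 1 ↦ 1, 2 ↦ 2, e ↦ 3, 0' ↦ 4, 1' ↦ 5, 2' ↦ 6
-- (e = 3 for F₇⁻⁴ and e = 4 for F₇⁻⁵).

triple : Fin 7 → Fin 7 → Fin 7 → Subset 7
triple a b c = tabulate (λ i → ⌊ i Data.Fin.≟ a ⌋ B.∨ ⌊ i Data.Fin.≟ b ⌋ B.∨ ⌊ i Data.Fin.≟ c ⌋)

e0 e1 e2 ee e0' e1' e2' : Fin 7
e0 = zero
e1 = suc zero
e2 = suc (suc zero)
ee = suc (suc (suc zero))
e0' = suc (suc (suc (suc zero)))
e1' = suc (suc (suc (suc (suc zero))))
e2' = suc (suc (suc (suc (suc (suc zero)))))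

isBasisExcept : List (Subset 7) → Subset 7 → Bool
isBasisExcept ex B = ⌊ ∣ B ∣ ℕ.≟ 3 ⌋ ∧ not (foldr (λ C b → ⌊ B ≟ˢ C ⌋ B.∨ b) false ex)

basesF7m4 : List (Subset 7)
basesF7m4 = filter (λ B → B.T? (isBasisExcept
  (triple ee e0 e0' ∷ triple ee e1 e1' ∷ triple ee e2 e2' ∷ []) B))
  (allSubsets 7)

basesF7m5 : List (Subset 7)
basesF7m5 = filter (λ B → B.T? (isBasisExcept
  (triple ee e0 e0' ∷ triple ee e2 e2' ∷ []) B))
  (allSubsets 7)

-- Substitution x_{0'} = x_0, x_{1'} = x_1, x_{2'} = x_2.
-- Variables of P_k are indexed by Fin 4 = {0,1,2,e}.

subst7→4 : Fin 7 → Fin 4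
subst7→4 zero = zero
subst7→4 (suc zero) = suc zero
subst7→4 (suc (suc zero)) = suc (suc zero)
subst7→4 (suc (suc (suc zero))) = suc (suc (suc zero))
subst7→4 (suc (suc (suc (suc zero)))) = zero
subst7→4 (suc (suc (suc (suc (suc zero))))) = suc zero
subst7→4 (suc (suc (suc (suc (suc (suc zero)))))) = suc (suc zero)

monomialExp : Subset 7 → (Fin 4 → ℕ)
monomialExp B v = Σ 7 (λ i → if lookup B i ∧ ⌊ subst7→4 i Data.Fin.≟ v ⌋ then 1 else 0)

-- A polynomial with nonnegative integer coefficients in variables Fin 4,
-- represented as a list of exponent vectors (each monomial with
-- coefficient 1, repetitions adding up).
Poly4 : Set
Poly4 = List (Fin 4 → ℕ)

substGen : List (Subset 7) → Poly4
substGen = map monomialExp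

P₁ P₂ : Poly4
P₁ = substGen basesF7m4
P₂ = substGen basesF7m5

-- Since all coefficients of such a polynomial are sums of 1's, an exponent
-- vector lies in supp(P) iff it occurs in the list.  Hence
-- r_{supp P}(S) = max { ∑_{i∈S} α_i | α ∈ supp P } is the maximum over the list.
rSupp : Poly4 → Subset 4 → ℕ
rSupp P S = maxList (map (sumOver S) P)

r₁ r₂ : Subset 4 → ℕ
r₁ = rSupp P₁
r₂ = rSupp P₂

-- Amalgam ground set {0,1,2,3,4} = Fin 5.
-- E₁ = {0,1,2,3} ↪ Fin 5 (3 ↦ 3), E₂ = {0,1,2,4} ↪ Fin 5 (e ↦ 4).

embed₁ : Subset 4 → Subset 5
embed₁ (a ∷ b ∷ c ∷ d ∷ []) = a ∷ b ∷ c ∷ d ∷ false ∷ []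

embed₂ : Subset 4 → Subset 5
embed₂ (a ∷ b ∷ c ∷ d ∷ []) = a ∷ b ∷ c ∷ false ∷ d ∷ []

IsAmalgam : (Subset 4 → ℕ) → (Subset 4 → ℕ) → (Subset 5 → ℕ) → Set
IsAmalgam ρ₁ ρ₂ r =
  IsPolymatroid r
  × (∀ S → r (embed₁ S) ≡ ρ₁ S)
  × (∀ S → r (embed₂ S) ≡ ρ₂ S)

{-# OPTIONS --safe #-}
module Submission where

-- An element i ∈ {0,1,2} of the polymatroids is the line {i,i'} of the matroid.  Both
-- extra points, 3 in F₇⁻⁴ and 4 in F₇⁻⁵, lie on the lines 0 and 2 (r(i e) = r(i) = 2m), so in
-- an amalgam the set {3,4} lies in the closure of both lines; as these span rank 3m,
-- submodularity gives r(02) + r(34) ≤ r(034) + r(234) = 4m, that is r(34) ≤ m.  But 3 lies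
-- on line 1 (r(13) = 2m) while 4 does not (r(14) = 3m), and r(14) + r(3) ≤ r(13) + r(34)
-- forces r(34) ≥ 2m.

open import Defs
open import Data.Nat using (ℕ; _≥_; _≤_; _+_; _*_; >-nonZero)
open import Data.Nat.Properties
  using ( ≤-trans; ≤-reflexive; +-mono-≤; +-cancelʳ-≤; +-cancelˡ-≤; *-distribˡ-+; *-cancelˡ-≤; n≮n
        ; module ≤-Reasoning)
open import Data.Fin using (#_)
open import Data.Fin.Subset using (Subset; _⊆_; _∪_; _∩_; ⁅_⁆)
open import Data.Fin.Subset.Properties using (_⊆?_; p⊆p∪q; q⊆p∪q; x∈p∪q⁺; x∈p∪q⁻; x∈p∩q⁺)
open import Data.Product using (∃; _,_)
open import Data.Sum using (inj₁; inj₂; [_,_])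
open import Function using (_∘_)
open import Relation.Nullary using (¬_)
open import Relation.Nullary.Decidable using (True; toWitness)
open import Relation.Binary.PropositionalEquality using (_≡_; sym; trans; cong; cong₂)

⊆-decide : ∀ {n} {U V : Subset n} {U⊆?V : True (U ⊆? V)} → U ⊆ V
⊆-decide {U⊆?V = U⊆?V} = toWitness U⊆?V

module _ {n : ℕ} {r : Subset n → ℕ} (poly : IsPolymatroid r) where
  open IsPolymatroid poly

  submodular-⊆ : ∀ {S T U V} → U ⊆ S ∪ T → V ⊆ S ∩ T → r U + r V ≤ r S + r T
  submodular-⊆ {S} {T} U⊆S∪T V⊆S∩T =
    ≤-trans (+-mono-≤ (monotone _ _ U⊆S∪T) (monotone _ _ V⊆S∩T)) (submodular S T)

  closure-∪ : ∀ {A X Y} → r (A ∪ X) ≤ r A → r (A ∪ Y) ≤ r A → r (A ∪ X ∪ Y) ≤ r A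
  closure-∪ {A} {X} {Y} rAX≤rA rAY≤rA = +-cancelʳ-≤ (r A) _ _
    (≤-trans (submodular-⊆ {A ∪ X} {A ∪ Y} A∪X∪Y⊆ A⊆) (+-mono-≤ rAX≤rA rAY≤rA))
    where
    A⊆ : A ⊆ (A ∪ X) ∩ (A ∪ Y)
    A⊆ x∈A = x∈p∩q⁺ (p⊆p∪q X x∈A , p⊆p∪q Y x∈A)
    A∪X∪Y⊆ : A ∪ X ∪ Y ⊆ (A ∪ X) ∪ (A ∪ Y)
    A∪X∪Y⊆ x∈ = [ p⊆p∪q (A ∪ Y) ∘ p⊆p∪q X
                , x∈p∪q⁺ ∘ [ inj₁ ∘ q⊆p∪q A X , inj₂ ∘ q⊆p∪q A Y ] ∘ x∈p∪q⁻ X Y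
                ] (x∈p∪q⁻ A (X ∪ Y) x∈)

module Amalgam (m : ℕ) {r : Subset 5 → ℕ} (poly : IsPolymatroid r)
  (r|E₁ : ∀ S → r (embed₁ S) ≡ m * r₁ S) (r|E₂ : ∀ S → r (embed₂ S) ≡ m * r₂ S) where
  open ≤-Reasoning

  -- The right-hand sides are r₁ and r₂ evaluated by the typechecker.
  r[0] : r ⁅ # 0 ⁆ ≡ m * 2
  r[0] = r|E₁ ⁅ # 0 ⁆
  r[2] : r ⁅ # 2 ⁆ ≡ m * 2
  r[2] = r|E₁ ⁅ # 2 ⁆
  r[3] : r ⁅ # 3 ⁆ ≡ m * 1
  r[3] = r|E₁ ⁅ # 3 ⁆
  r[03] : r (⁅ # 0 ⁆ ∪ ⁅ # 3 ⁆) ≡ m * 2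
  r[03] = r|E₁ (⁅ # 0 ⁆ ∪ ⁅ # 3 ⁆)
  r[23] : r (⁅ # 2 ⁆ ∪ ⁅ # 3 ⁆) ≡ m * 2
  r[23] = r|E₁ (⁅ # 2 ⁆ ∪ ⁅ # 3 ⁆)
  r[13] : r (⁅ # 1 ⁆ ∪ ⁅ # 3 ⁆) ≡ m * 2
  r[13] = r|E₁ (⁅ # 1 ⁆ ∪ ⁅ # 3 ⁆)
  r[02] : r (⁅ # 0 ⁆ ∪ ⁅ # 2 ⁆) ≡ m * 3
  r[02] = r|E₁ (⁅ # 0 ⁆ ∪ ⁅ # 2 ⁆)

  -- embed₂ sends index 3 of Fin 4, the point 4 of E₂ = {0,1,2,4}, to 4.
  r[04] : r (⁅ # 0 ⁆ ∪ ⁅ # 4 ⁆) ≡ m * 2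
  r[04] = r|E₂ (⁅ # 0 ⁆ ∪ ⁅ # 3 ⁆)
  r[24] : r (⁅ # 2 ⁆ ∪ ⁅ # 4 ⁆) ≡ m * 2
  r[24] = r|E₂ (⁅ # 2 ⁆ ∪ ⁅ # 3 ⁆)
  r[14] : r (⁅ # 1 ⁆ ∪ ⁅ # 4 ⁆) ≡ m * 3
  r[14] = r|E₂ (⁅ # 1 ⁆ ∪ ⁅ # 3 ⁆)

  r[i34]≤2m : ∀ i → r ⁅ i ⁆ ≡ m * 2 → r (⁅ i ⁆ ∪ ⁅ # 3 ⁆) ≡ m * 2 → r (⁅ i ⁆ ∪ ⁅ # 4 ⁆) ≡ m * 2 →
              r (⁅ i ⁆ ∪ ⁅ # 3 ⁆ ∪ ⁅ # 4 ⁆) ≤ m * 2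
  r[i34]≤2m i r[i] r[i3] r[i4] = begin
    r (⁅ i ⁆ ∪ ⁅ # 3 ⁆ ∪ ⁅ # 4 ⁆)
      ≤⟨ closure-∪ poly {⁅ i ⁆} {⁅ # 3 ⁆} {⁅ # 4 ⁆} (on-line r[i3]) (on-line r[i4]) ⟩
    r ⁅ i ⁆
      ≡⟨ r[i] ⟩
    m * 2
      ∎
    where
    on-line : ∀ {A} → r A ≡ m * 2 → r A ≤ r ⁅ i ⁆
    on-line r[A] = ≤-reflexive (trans r[A] (sym r[i]))

  r[34]≤m : r (⁅ # 3 ⁆ ∪ ⁅ # 4 ⁆) ≤ m * 1
  r[34]≤m = +-cancelˡ-≤ (m * 3) _ _ (begin
    m * 3 + r (⁅ # 3 ⁆ ∪ ⁅ # 4 ⁆)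
      ≡⟨ cong (_+ r (⁅ # 3 ⁆ ∪ ⁅ # 4 ⁆)) (sym r[02]) ⟩
    r (⁅ # 0 ⁆ ∪ ⁅ # 2 ⁆) + r (⁅ # 3 ⁆ ∪ ⁅ # 4 ⁆)
      ≤⟨ submodular-⊆ poly ⊆-decide ⊆-decide ⟩
    r (⁅ # 0 ⁆ ∪ ⁅ # 3 ⁆ ∪ ⁅ # 4 ⁆) + r (⁅ # 2 ⁆ ∪ ⁅ # 3 ⁆ ∪ ⁅ # 4 ⁆)
      ≤⟨ +-mono-≤ (r[i34]≤2m (# 0) r[0] r[03] r[04]) (r[i34]≤2m (# 2) r[2] r[23] r[24]) ⟩
    m * 2 + m * 2
      ≡⟨ sym (*-distribˡ-+ m 2 2) ⟩
    m * 4
      ≡⟨ *-distribˡ-+ m 3 1 ⟩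
    m * 3 + m * 1
      ∎)

  2m≤r[34] : m * 2 ≤ r (⁅ # 3 ⁆ ∪ ⁅ # 4 ⁆)
  2m≤r[34] = +-cancelˡ-≤ (m * 2) _ _ (begin
    m * 2 + m * 2                                 ≡⟨ sym (*-distribˡ-+ m 2 2) ⟩
    m * 4                                         ≡⟨ *-distribˡ-+ m 3 1 ⟩
    m * 3 + m * 1                                 ≡⟨ sym (cong₂ _+_ r[14] r[3]) ⟩
    r (⁅ # 1 ⁆ ∪ ⁅ # 4 ⁆) + r ⁅ # 3 ⁆             ≤⟨ submodular-⊆ poly ⊆-decide ⊆-decide ⟩
    r (⁅ # 1 ⁆ ∪ ⁅ # 3 ⁆) + r (⁅ # 3 ⁆ ∪ ⁅ # 4 ⁆) ≡⟨ cong (_+ r (⁅ # 3 ⁆ ∪ ⁅ # 4 ⁆)) r[13] ⟩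
    m * 2 + r (⁅ # 3 ⁆ ∪ ⁅ # 4 ⁆)                 ∎)

theorem3p5 : (m : ℕ) → m ≥ 1 → ¬ (∃ λ (r : Subset 5 → ℕ) → IsAmalgam (m ·ʳ r₁) (m ·ʳ r₂) r)
theorem3p5 m m≥1 (r , poly , r|E₁ , r|E₂) =
  n≮n 1 (*-cancelˡ-≤ m {{>-nonZero m≥1}} (≤-trans 2m≤r[34] r[34]≤m))
  where open Amalgam m poly r|E₁ r|E₂
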